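{- Let $P$ be a positive logic and $L=\mathrm{Int}+P$. Let $\mathcal{R}$ be a set of positive multiple-conclusion rules and $r$ a positive multiple-conclusion rule. Then $r$ $P$-follows from $\mathcal{R}$ if and only if $r$ $L$-follows from $\mathcal{R}$.
   Context: Formulas are built from a countable set of propositional variables using $\land,\lor,\to$ and the constant $\bot$. Positive formulas are those not containing $\bot$. $\mathrm{Int}$ is the set of intuitionistic propositional theorems and $\mathrm{Int}^+$ its set of positive members. A positive logic is a set of positive formulas containing $\mathrm{Int}^+$ and closed under modus ponens and substitutions of positive formulas for variables. $\mathrm{Int}+P$ is the least set of formulas containing $\mathrm{Int}\cup P$ and closed under modus ponens and arbitrary substitutions. A Brouwerian algebra is an algebra $(A,\land,\lor,\to,1)$ in which $(A,\land,\lor)$ is a distributive lattice with top $1$ and $\to$ is relative pseudo-complementation. A Heyting algebra additionally has a constant $0$ which is the least element. A valuation in an algebra assigns elements to variables and extends to formulas. A multiple-conclusion rule $\Gamma/\Delta$ is a pair of finite sets of formulas; it is positive if all its formulas are positive. A rule is valid in an algebra if every valuation sending all formulas of $\Gamma$ to $1$ sends at least one formula of $\Delta$ to $1$. For an si-logic $L$, $V_L$ is the variety of Heyting algebras in which all formulas of $L$ are valid; for a positive logic $P$, $V_P$ is the variety of Brouwerian algebras in which all formulas of $P$ are valid. For a logic $X$ (si or positive), a rule $r$ $X$-follows from a set of rules $\mathcal{R}$ if every algebra in $V_X$ in which all rules of $\mathcal{R}$ are valid also validates $r$. -}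

module Defs where

open import Level using (Level; _⊔_; suc)
open import Data.Nat using (ℕ)
open import Data.Product using (_×_)
open import Data.List using (List; map)
open import Data.List.Relation.Unary.All using (All)
open import Data.List.Relation.Unary.Any using (Any)
open import Relation.Binary.Core using (Rel)
open import Relation.Binary.Structures using (IsEquivalence)
open import Algebra.Core using (Op₂)
open import Algebra.Lattice.Structures using (IsDistributiveLattice)

infixr 5 _⇒_
infixr 6 _∨'_
infixr 7 _∧'_
data Formula : Set where
  var   : ℕ → Formula
  _∧'_  : Formula → Formula → Formula
  _∨'_  : Formula → Formula → Formula
  _⇒_   : Formula → Formula → Formula
  ⊥'    : Formula

infixr 5 _⇒⁺_
data PFormula : Set where
  pvar   : ℕ → PFormula
  _∧⁺_   : PFormula → PFormula → PFormula
  _∨⁺_   : PFormula → PFormula → PFormula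
  _⇒⁺_   : PFormula → PFormula → PFormula

embed : PFormula → Formula
embed (pvar n)  = var n
embed (a ∧⁺ b)  = embed a ∧' embed b
embed (a ∨⁺ b)  = embed a ∨' embed b
embed (a ⇒⁺ b)  = embed a ⇒ embed b

subst : (ℕ → Formula) → Formula → Formula
subst σ (var n)  = σ n
subst σ (a ∧' b) = subst σ a ∧' subst σ b
subst σ (a ∨' b) = subst σ a ∨' subst σ b
subst σ (a ⇒ b)  = subst σ a ⇒ subst σ b
subst σ ⊥'       = ⊥'

psubst : (ℕ → PFormula) → PFormula → PFormula
psubst σ (pvar n) = σ n
psubst σ (a ∧⁺ b) = psubst σ a ∧⁺ psubst σ b
psubst σ (a ∨⁺ b) = psubst σ a ∨⁺ psubst σ b
psubst σ (a ⇒⁺ b) = psubst σ a ⇒⁺ psubst σ b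

data IntAxiom : Formula → Set where
  K    : ∀ a b → IntAxiom (a ⇒ b ⇒ a)
  S    : ∀ a b c → IntAxiom ((a ⇒ b ⇒ c) ⇒ (a ⇒ b) ⇒ a ⇒ c)
  ∧E₁  : ∀ a b → IntAxiom (a ∧' b ⇒ a)
  ∧E₂  : ∀ a b → IntAxiom (a ∧' b ⇒ b)
  ∧I   : ∀ a b → IntAxiom (a ⇒ b ⇒ a ∧' b)
  ∨I₁  : ∀ a b → IntAxiom (a ⇒ a ∨' b)
  ∨I₂  : ∀ a b → IntAxiom (b ⇒ a ∨' b)
  ∨E   : ∀ a b c → IntAxiom ((a ⇒ c) ⇒ (b ⇒ c) ⇒ (a ∨' b ⇒ c))
  EFQ  : ∀ a → IntAxiom (⊥' ⇒ a)

data IntPlus (X : Formula → Set) : Formula → Set where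
  ax   : ∀ {a} → IntAxiom a → IntPlus X a
  hyp  : ∀ {a} → X a → IntPlus X a
  mp   : ∀ {a b} → IntPlus X a → IntPlus X (a ⇒ b) → IntPlus X b
  sub  : ∀ {a} (σ : ℕ → Formula) → IntPlus X a → IntPlus X (subst σ a)

data Empty : Formula → Set where

Int : Formula → Set
Int = IntPlus Empty

IntPos : PFormula → Set
IntPos a = Int (embed a)

record PositiveLogic (P : PFormula → Set) : Set where
  field
    containsIntPos : ∀ a → IntPos a → P a
    closedMP       : ∀ a b → P a → P (a ⇒⁺ b) → P b
    closedSubst    : ∀ (σ : ℕ → PFormula) a → P a → P (psubst σ a)

data InP (P : PFormula → Set) : Formula → Set where
  inj : ∀ b → P b → InP P (embed b)

IntPlusP : (PFormula → Set) → Formula → Set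
IntPlusP P = IntPlus (InP P)

record BrouwerianAlgebra (c ℓ : Level) : Set (suc (c ⊔ ℓ)) where
  infix  4 _≈_ _≤_
  infixr 5 _⇨_
  field
    Carrier  : Set c
    _≈_      : Rel Carrier ℓ
    _∧_      : Op₂ Carrier
    _∨_      : Op₂ Carrier
    _⇨_      : Op₂ Carrier
    ⊤        : Carrier
    isDistributiveLattice : IsDistributiveLattice _≈_ _∨_ _∧_

  _≤_ : Rel Carrier ℓ
  x ≤ y = (x ∧ y) ≈ x

  field
    ⊤-max    : ∀ x → x ≤ ⊤
    ⇨-intro  : ∀ x y z → (x ∧ y) ≤ z → x ≤ (y ⇨ z)
    ⇨-elim   : ∀ x y z → x ≤ (y ⇨ z) → (x ∧ y) ≤ z

record HeytingAlgebra (c ℓ : Level) : Set (suc (c ⊔ ℓ)) where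
  field
    brouwerian : BrouwerianAlgebra c ℓ
  open BrouwerianAlgebra brouwerian
  field
    ⊥        : Carrier
    ⊥-min    : ∀ x → ⊥ ≤ x

module _ {c ℓ} (B : BrouwerianAlgebra c ℓ) where
  open BrouwerianAlgebra B
  ⟦_⟧ᴮ : PFormula → (ℕ → Carrier) → Carrier
  ⟦ pvar n ⟧ᴮ v = v n
  ⟦ a ∧⁺ b ⟧ᴮ v = ⟦ a ⟧ᴮ v ∧ ⟦ b ⟧ᴮ v
  ⟦ a ∨⁺ b ⟧ᴮ v = ⟦ a ⟧ᴮ v ∨ ⟦ b ⟧ᴮ v
  ⟦ a ⇒⁺ b ⟧ᴮ v = ⟦ a ⟧ᴮ v ⇨ ⟦ b ⟧ᴮ v

module _ {c ℓ} (H : HeytingAlgebra c ℓ) where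
  open HeytingAlgebra H
  open BrouwerianAlgebra brouwerian
  ⟦_⟧ᴴ : Formula → (ℕ → Carrier) → Carrier
  ⟦ var n ⟧ᴴ v  = v n
  ⟦ a ∧' b ⟧ᴴ v = ⟦ a ⟧ᴴ v ∧ ⟦ b ⟧ᴴ v
  ⟦ a ∨' b ⟧ᴴ v = ⟦ a ⟧ᴴ v ∨ ⟦ b ⟧ᴴ v
  ⟦ a ⇒ b ⟧ᴴ v  = ⟦ a ⟧ᴴ v ⇨ ⟦ b ⟧ᴴ v
  ⟦ ⊥' ⟧ᴴ v     = ⊥

BValid : ∀ {c ℓ} → BrouwerianAlgebra c ℓ → PFormula → Set (c ⊔ ℓ)
BValid B a = ∀ v → BrouwerianAlgebra._≈_ B (⟦_⟧ᴮ B a v) (BrouwerianAlgebra.⊤ B)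

HValid : ∀ {c ℓ} → HeytingAlgebra c ℓ → Formula → Set (c ⊔ ℓ)
HValid H a = ∀ v → BrouwerianAlgebra._≈_ (HeytingAlgebra.brouwerian H)
                      (⟦_⟧ᴴ H a v) (BrouwerianAlgebra.⊤ (HeytingAlgebra.brouwerian H))

InVP : ∀ {c ℓ} → (PFormula → Set) → BrouwerianAlgebra c ℓ → Set (c ⊔ ℓ)
InVP P B = ∀ a → P a → BValid B a

InVL : ∀ {c ℓ} → (Formula → Set) → HeytingAlgebra c ℓ → Set (c ⊔ ℓ)
InVL L H = ∀ a → L a → HValid H a

record Rule (F : Set) : Set where
  constructor _/_
  field
    premises    : List F
    conclusions : List F

PRule : Set
PRule = Rule PFormula

embedRule : PRule → Rule Formula
embedRule (Γ / Δ) = map embed Γ / map embed Δ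

BRuleValid : ∀ {c ℓ} → BrouwerianAlgebra c ℓ → PRule → Set (c ⊔ ℓ)
BRuleValid B (Γ / Δ) =
  ∀ v → All (λ a → BrouwerianAlgebra._≈_ B (⟦_⟧ᴮ B a v) (BrouwerianAlgebra.⊤ B)) Γ
      → Any (λ a → BrouwerianAlgebra._≈_ B (⟦_⟧ᴮ B a v) (BrouwerianAlgebra.⊤ B)) Δ

HRuleValid : ∀ {c ℓ} → HeytingAlgebra c ℓ → Rule Formula → Set (c ⊔ ℓ)
HRuleValid H (Γ / Δ) =
  ∀ v → All (λ a → BrouwerianAlgebra._≈_ (HeytingAlgebra.brouwerian H)
                     (⟦_⟧ᴴ H a v) (BrouwerianAlgebra.⊤ (HeytingAlgebra.brouwerian H))) Γ
      → Any (λ a → BrouwerianAlgebra._≈_ (HeytingAlgebra.brouwerian H)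
                     (⟦_⟧ᴴ H a v) (BrouwerianAlgebra.⊤ (HeytingAlgebra.brouwerian H))) Δ

PFollows : (c ℓ : Level) → (PFormula → Set) → (PRule → Set) → PRule → Set (suc (c ⊔ ℓ))
PFollows c ℓ P ℛ r =
  (B : BrouwerianAlgebra c ℓ) → InVP P B →
  (∀ s → ℛ s → BRuleValid B s) → BRuleValid B r

LFollows : (c ℓ : Level) → (Formula → Set) → (PRule → Set) → PRule → Set (suc (c ⊔ ℓ))
LFollows c ℓ L ℛ r =
  (H : HeytingAlgebra c ℓ) → InVL L H →
  (∀ s → ℛ s → HRuleValid H (embedRule s)) → HRuleValid H (embedRule r)

module Submission where

-- (⇒) A Heyting algebra H ∈ V_L is, forgetting ⊥, a Brouwerian algebra in
-- V_P, and it evaluates positive formulas exactly as that reduct does, so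
-- positive rules are valid in H iff they are valid in the reduct.
--
-- (⇐) Let B ∈ V_P validate ℛ, and let v be a valuation making the premises
-- of r = Γ / Δ true.  Take k to be the meet of the values of all variables
-- occurring in Γ and Δ.  Identifying x and y when x ∨ k = y ∨ k yields the
-- quotient B/k ≅ ↑k, a Heyting algebra with least element k, and x ↦ x ∨ k
-- is a homomorphism B/k → B for the positive connectives.  Hence a positive
-- formula is true in B/k under u iff it is true in B under u ∨ k, so B/k
-- inherits every positive formula and rule valid in B; by soundness of
-- Int + P it lies in V_L and validates ℛ, hence it validates r.  Finally,
-- on the formulas of Γ and Δ the shifted valuation v ∨ k agrees with v
-- (every variable value there is already above k), so truth at v in B/k is
-- truth at v in B, and r holds at v in B.

open import Defs
open import Level using (Level)
open import Function.Base using (_∘′_)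
open import Function.Bundles using (_⇔_; mk⇔; Equivalence)
import Function.Properties.Equivalence as ⇔
open import Data.Nat using (ℕ)
open import Data.Product using (_×_; _,_; proj₁; proj₂)
open import Data.List using (List; []; _∷_; _++_; map)
open import Data.List.Relation.Unary.All as All using (All; []; _∷_)
open import Data.List.Relation.Unary.Any using (Any; here; there)
import Data.List.Relation.Unary.All.Properties as Allₚ
import Data.List.Relation.Unary.Any.Properties as Anyₚ
open import Relation.Binary.PropositionalEquality as ≡ using (_≡_)
open import Relation.Binary.Core using (Rel)
open import Algebra.Lattice.Bundles using (Lattice)
open import Algebra.Lattice.Structures using (IsDistributiveLattice; IsLattice)
import Algebra.Lattice.Properties.Lattice as LatticeProperties
import Relation.Binary.Lattice as OrderLattice
import Relation.Binary.Reasoning.PartialOrder as PosetReasoning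

open Equivalence using (to; from)

RuleHolds : ∀ {t} → (PFormula → Set t) → PRule → Set t
RuleHolds T (Γ / Δ) = All T Γ → Any T Δ

module _ {t} {T₁ T₂ : PFormula → Set t} where

  any-apply : ∀ {xs} → All (λ a → T₁ a → T₂ a) xs → Any T₁ xs → Any T₂ xs
  any-apply (f ∷ _)  (here p)  = here (f p)
  any-apply (_ ∷ fs) (there p) = there (any-apply fs p)

  ruleHolds-transfer : ∀ Γ Δ →
    All (λ a → T₂ a → T₁ a) Γ → All (λ a → T₁ a → T₂ a) Δ →
    RuleHolds T₁ (Γ / Δ) → RuleHolds T₂ (Γ / Δ)
  ruleHolds-transfer Γ Δ reflect preserve holds premises =
    any-apply preserve (holds (All.zipWith (λ (f , p) → f p) (reflect , premises)))

  ruleHolds-cong : (∀ a → T₁ a ⇔ T₂ a) → ∀ r → RuleHolds T₁ r → RuleHolds T₂ r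
  ruleHolds-cong eq (Γ / Δ) =
    ruleHolds-transfer Γ Δ (All.tabulate (λ {a} _ → from (eq a)))
                           (All.tabulate (λ {a} _ → to (eq a)))

module BrouwerianOrder {c ℓ : Level} (B : BrouwerianAlgebra c ℓ) where
  open BrouwerianAlgebra B using (Carrier; _≈_; _∧_; _∨_; _⇨_; ⊤;
    isDistributiveLattice; ⊤-max; ⇨-intro; ⇨-elim)
  open IsDistributiveLattice isDistributiveLattice public

  -- x ⊑ y is x ≈ x ∧ y: the record's own order x ∧ y ≈ x, read backwards.
  private
    lattice : Lattice c ℓ
    lattice = record { isLattice = isLattice }

    orderLattice : OrderLattice.Lattice c ℓ ℓ
    orderLattice = LatticeProperties.∨-∧-orderTheoreticLattice lattice

  open OrderLattice.Lattice orderLattice using (x∧y≤x; x∧y≤y; x≤x∨y; y≤x∨y)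
  open OrderLattice.Lattice orderLattice public
    using (∧-greatest; ∨-least; antisym; poset)
    renaming (_≤_ to _⊑_; trans to ⊑-trans; refl to ⊑-refl; reflexive to ≈⇒⊑)

  ∧⊑ˡ : ∀ {x y} → x ∧ y ⊑ x
  ∧⊑ˡ = x∧y≤x _ _

  ∧⊑ʳ : ∀ {x y} → x ∧ y ⊑ y
  ∧⊑ʳ = x∧y≤y _ _

  ⊑∨ˡ : ∀ {x y} → x ⊑ x ∨ y
  ⊑∨ˡ = x≤x∨y _ _

  ⊑∨ʳ : ∀ {x y} → y ⊑ x ∨ y
  ⊑∨ʳ = y≤x∨y _ _

  ⊑⊤ : ∀ {x} → x ⊑ ⊤
  ⊑⊤ {x} = sym (⊤-max x)

  curry : ∀ {x y z} → x ∧ y ⊑ z → x ⊑ y ⇨ z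
  curry {x} {y} {z} p = sym (⇨-intro x y z (sym p))

  uncurry : ∀ {x y z} → x ⊑ y ⇨ z → x ∧ y ⊑ z
  uncurry {x} {y} {z} p = sym (⇨-elim x y z (sym p))

  modus-ponens : ∀ {x y z} → x ⊑ y ⇨ z → x ⊑ y → x ⊑ z
  modus-ponens p q = ⊑-trans (∧-greatest ⊑-refl q) (uncurry p)

  ⊤⊑⇒≈⊤ : ∀ {x} → ⊤ ⊑ x → x ≈ ⊤
  ⊤⊑⇒≈⊤ p = antisym ⊑⊤ p

  ≈⊤⇒⊤⊑ : ∀ {x} → x ≈ ⊤ → ⊤ ⊑ x
  ≈⊤⇒⊤⊑ p = ≈⇒⊑ (sym p)

  ⇨-mono : ∀ {x y x' y'} → x' ⊑ x → y ⊑ y' → x ⇨ y ⊑ x' ⇨ y'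
  ⇨-mono p q = curry (⊑-trans (modus-ponens ∧⊑ˡ (⊑-trans ∧⊑ʳ p)) q)

  ⇨-cong : ∀ {x y x' y'} → x ≈ x' → y ≈ y' → x ⇨ y ≈ x' ⇨ y'
  ⇨-cong p q = antisym (⇨-mono (≈⇒⊑ (sym p)) (≈⇒⊑ q)) (⇨-mono (≈⇒⊑ p) (≈⇒⊑ (sym q)))

  ⊑⇒∨≈ : ∀ {k w} → k ⊑ w → w ∨ k ≈ w
  ⊑⇒∨≈ p = antisym (∨-least ⊑-refl p) ⊑∨ˡ

  ⋀ : List Carrier → Carrier
  ⋀ []       = ⊤
  ⋀ (x ∷ xs) = x ∧ ⋀ xs

  ⋀-lower : ∀ xs → All (⋀ xs ⊑_) xs
  ⋀-lower []       = []
  ⋀-lower (x ∷ xs) = ∧⊑ˡ ∷ All.map (⊑-trans ∧⊑ʳ) (⋀-lower xs)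

TrueAt : ∀ {c ℓ} (B : BrouwerianAlgebra c ℓ) → (ℕ → BrouwerianAlgebra.Carrier B) →
         PFormula → Set ℓ
TrueAt B v a = BrouwerianAlgebra._≈_ B (⟦_⟧ᴮ B a v) (BrouwerianAlgebra.⊤ B)

module Shift {c ℓ : Level} (B : BrouwerianAlgebra c ℓ) where
  open BrouwerianAlgebra B using (Carrier; _≈_; _∧_; _∨_)
  open BrouwerianOrder B

  shift : (ℕ → Carrier) → Carrier → ℕ → Carrier
  shift v k n = v n ∨ k

  varMeet : (ℕ → Carrier) → PFormula → Carrier
  varMeet v (pvar n) = v n
  varMeet v (a ∧⁺ b) = varMeet v a ∧ varMeet v b
  varMeet v (a ∨⁺ b) = varMeet v a ∧ varMeet v b
  varMeet v (a ⇒⁺ b) = varMeet v a ∧ varMeet v b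

  shift-invisible : ∀ v k a → k ⊑ varMeet v a → ⟦_⟧ᴮ B a (shift v k) ≈ ⟦_⟧ᴮ B a v
  shift-invisible v k (pvar n) p = ⊑⇒∨≈ p
  shift-invisible v k (a ∧⁺ b) p =
    ∧-cong (shift-invisible v k a (⊑-trans p ∧⊑ˡ)) (shift-invisible v k b (⊑-trans p ∧⊑ʳ))
  shift-invisible v k (a ∨⁺ b) p =
    ∨-cong (shift-invisible v k a (⊑-trans p ∧⊑ˡ)) (shift-invisible v k b (⊑-trans p ∧⊑ʳ))
  shift-invisible v k (a ⇒⁺ b) p =
    ⇨-cong (shift-invisible v k a (⊑-trans p ∧⊑ˡ)) (shift-invisible v k b (⊑-trans p ∧⊑ʳ))

module Reduct {c ℓ : Level} (H : HeytingAlgebra c ℓ) where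
  open HeytingAlgebra H using (brouwerian)
  open BrouwerianAlgebra brouwerian using (_≈_; _∧_; _∨_; _⇨_; ⊤)

  eval-embed : ∀ a v → ⟦_⟧ᴴ H (embed a) v ≡ ⟦_⟧ᴮ brouwerian a v
  eval-embed (pvar n) v = ≡.refl
  eval-embed (a ∧⁺ b) v = ≡.cong₂ _∧_ (eval-embed a v) (eval-embed b v)
  eval-embed (a ∨⁺ b) v = ≡.cong₂ _∨_ (eval-embed a v) (eval-embed b v)
  eval-embed (a ⇒⁺ b) v = ≡.cong₂ _⇨_ (eval-embed a v) (eval-embed b v)

  truth-embed : ∀ v a → (⟦_⟧ᴴ H (embed a) v ≈ ⊤) ⇔ TrueAt brouwerian v a
  truth-embed v a = mk⇔ (≡.subst (_≈ ⊤) (eval-embed a v))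
                        (≡.subst (_≈ ⊤) (≡.sym (eval-embed a v)))

  valid-embed : ∀ a → HValid H (embed a) ⇔ BValid brouwerian a
  valid-embed a = mk⇔ (λ h v → to (truth-embed v a) (h v))
                      (λ h v → from (truth-embed v a) (h v))

  rule-embed : ∀ s → HRuleValid H (embedRule s) ⇔ BRuleValid brouwerian s
  rule-embed (Γ / Δ) = mk⇔
    (λ h v → ruleHolds-cong (truth-embed v) (Γ / Δ)
               (Anyₚ.map⁻ ∘′ h v ∘′ Allₚ.map⁺))
    (λ h v → Anyₚ.map⁺ ∘′ ruleHolds-cong (λ a → ⇔.sym (truth-embed v a)) (Γ / Δ) (h v)
               ∘′ Allₚ.map⁻)

module Soundness {c ℓ : Level} (H : HeytingAlgebra c ℓ) where
  open HeytingAlgebra H using (brouwerian; ⊥-min)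
  open BrouwerianAlgebra brouwerian using (_≈_; _∧_; _∨_; _⇨_; ⊤)
  open BrouwerianOrder brouwerian

  eval-subst : ∀ σ a v → ⟦_⟧ᴴ H (subst σ a) v ≡ ⟦_⟧ᴴ H a (λ n → ⟦_⟧ᴴ H (σ n) v)
  eval-subst σ (var n)  v = ≡.refl
  eval-subst σ (a ∧' b) v = ≡.cong₂ _∧_ (eval-subst σ a v) (eval-subst σ b v)
  eval-subst σ (a ∨' b) v = ≡.cong₂ _∨_ (eval-subst σ a v) (eval-subst σ b v)
  eval-subst σ (a ⇒ b)  v = ≡.cong₂ _⇨_ (eval-subst σ a v) (eval-subst σ b v)
  eval-subst σ ⊥'       v = ≡.refl

  axiom-valid : ∀ {a} → IntAxiom a → HValid H a
  axiom-valid (K a b)     v = ⊤⊑⇒≈⊤ (curry (curry (⊑-trans ∧⊑ˡ ∧⊑ʳ)))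
  axiom-valid (S a b c)   v = ⊤⊑⇒≈⊤ (curry (curry (curry
    (modus-ponens (modus-ponens (⊑-trans ∧⊑ˡ (⊑-trans ∧⊑ˡ ∧⊑ʳ)) ∧⊑ʳ)
                  (modus-ponens (⊑-trans ∧⊑ˡ ∧⊑ʳ) ∧⊑ʳ)))))
  axiom-valid (∧E₁ a b)   v = ⊤⊑⇒≈⊤ (curry (⊑-trans ∧⊑ʳ ∧⊑ˡ))
  axiom-valid (∧E₂ a b)   v = ⊤⊑⇒≈⊤ (curry (⊑-trans ∧⊑ʳ ∧⊑ʳ))
  axiom-valid (∧I a b)    v = ⊤⊑⇒≈⊤ (curry (curry (∧-greatest (⊑-trans ∧⊑ˡ ∧⊑ʳ) ∧⊑ʳ)))
  axiom-valid (∨I₁ a b)   v = ⊤⊑⇒≈⊤ (curry (⊑-trans ∧⊑ʳ ⊑∨ˡ))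
  axiom-valid (∨I₂ a b)   v = ⊤⊑⇒≈⊤ (curry (⊑-trans ∧⊑ʳ ⊑∨ʳ))
  axiom-valid (∨E a b c)  v = ⊤⊑⇒≈⊤ (curry (curry (curry
    (⊑-trans (≈⇒⊑ (∧-distribˡ-∨ _ _ _))
      (∨-least (modus-ponens (⊑-trans ∧⊑ˡ (⊑-trans ∧⊑ˡ ∧⊑ʳ)) ∧⊑ʳ)
               (modus-ponens (⊑-trans ∧⊑ˡ ∧⊑ʳ) ∧⊑ʳ))))))
  axiom-valid (EFQ a)     v = ⊤⊑⇒≈⊤ (curry (⊑-trans ∧⊑ʳ (sym (⊥-min _))))

  soundness : ∀ {X : Formula → Set} → (∀ b → X b → HValid H b) →
              ∀ {a} → IntPlus X a → HValid H a
  soundness X-valid (ax axiom)   = axiom-valid axiom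
  soundness X-valid (hyp x)      = X-valid _ x
  soundness X-valid (mp d e)   v =
    ⊤⊑⇒≈⊤ (modus-ponens (≈⊤⇒⊤⊑ (soundness X-valid e v)) (≈⊤⇒⊤⊑ (soundness X-valid d v)))
  soundness X-valid (sub {a} σ d) v =
    ≡.subst (_≈ ⊤) (≡.sym (eval-subst σ a v)) (soundness X-valid d _)

-- It is (isomorphic to) the upset ↑k, hence a
-- Heyting algebra with least element k; its implication is x ⇨ (y ∨ k).
-- The carrier stays that of B, which keeps B/k at the universe levels of B.
module Quotient {c ℓ : Level} (B : BrouwerianAlgebra c ℓ) (k : BrouwerianAlgebra.Carrier B) where
  open BrouwerianAlgebra B using (Carrier; _≈_; _∧_; _∨_; _⇨_; ⊤; ⊤-max)
  open BrouwerianOrder B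
  open Shift B using (shift; varMeet; shift-invisible)

  infix 4 _≈ₖ_
  _≈ₖ_ : Rel Carrier ℓ
  x ≈ₖ y = x ∨ k ≈ y ∨ k

  quotient-order : ∀ {x y} → x ∧ y ≈ₖ x ⇔ x ⊑ y ∨ k
  quotient-order {x} {y} = mk⇔ forwards backwards
    where
    forwards : x ∧ y ≈ₖ x → x ⊑ y ∨ k
    forwards eq = begin
      x            ≤⟨ ⊑∨ˡ ⟩
      x ∨ k        ≈⟨ eq ⟨
      (x ∧ y) ∨ k  ≤⟨ ∨-least (⊑-trans ∧⊑ʳ ⊑∨ˡ) ⊑∨ʳ ⟩
      y ∨ k        ∎
      where open PosetReasoning poset
    x⊑x∧y∨k : x ⊑ y ∨ k → x ⊑ (x ∧ y) ∨ k
    x⊑x∧y∨k x⊑y∨k = begin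
      x                  ≤⟨ ∧-greatest ⊑-refl x⊑y∨k ⟩
      x ∧ (y ∨ k)        ≈⟨ ∧-distribˡ-∨ x y k ⟩
      (x ∧ y) ∨ (x ∧ k)  ≤⟨ ∨-least ⊑∨ˡ (⊑-trans ∧⊑ʳ ⊑∨ʳ) ⟩
      (x ∧ y) ∨ k        ∎
      where open PosetReasoning poset
    backwards : x ⊑ y ∨ k → x ∧ y ≈ₖ x
    backwards x⊑y∨k = antisym (∨-least (⊑-trans ∧⊑ˡ ⊑∨ˡ) ⊑∨ʳ)
                              (∨-least (x⊑x∧y∨k x⊑y∨k) ⊑∨ʳ)

  k⊑⇨ₖ : ∀ {x y} → k ⊑ x ⇨ (y ∨ k)
  k⊑⇨ₖ = curry (⊑-trans ∧⊑ˡ ⊑∨ʳ)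

  ∨k-∧ : ∀ {x y} → (x ∧ y) ∨ k ≈ (x ∨ k) ∧ (y ∨ k)
  ∨k-∧ {x} {y} = ∨-distribʳ-∧ k x y

  ∨k-∨ : ∀ {x y} → (x ∨ y) ∨ k ≈ (x ∨ k) ∨ (y ∨ k)
  ∨k-∨ = antisym
    (∨-least (∨-least (⊑-trans ⊑∨ˡ ⊑∨ˡ) (⊑-trans ⊑∨ˡ ⊑∨ʳ)) (⊑-trans ⊑∨ʳ ⊑∨ʳ))
    (∨-least (∨-least (⊑-trans ⊑∨ˡ ⊑∨ˡ) ⊑∨ʳ) (∨-least (⊑-trans ⊑∨ʳ ⊑∨ˡ) ⊑∨ʳ))

  ∨k-⇨ : ∀ {x y} → (x ⇨ (y ∨ k)) ∨ k ≈ (x ∨ k) ⇨ (y ∨ k)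
  ∨k-⇨ {x} {y} = trans (⊑⇒∨≈ k⊑⇨ₖ) (antisym (curry ⇨∧x∨k⊑) (⇨-mono ⊑∨ˡ ⊑-refl))
    where
    ⇨∧x∨k⊑ : (x ⇨ (y ∨ k)) ∧ (x ∨ k) ⊑ y ∨ k
    ⇨∧x∨k⊑ = ⊑-trans (≈⇒⊑ (∧-distribˡ-∨ _ x k))
                     (∨-least (uncurry ⊑-refl) (⊑-trans ∧⊑ʳ ⊑∨ʳ))

  ≈ₖ-isLattice : IsLattice _≈ₖ_ _∨_ _∧_
  ≈ₖ-isLattice = record
    { isEquivalence = record { refl = refl ; sym = sym ; trans = trans }
    ; ∨-comm        = λ x y → ∨-congʳ (∨-comm x y)
    ; ∨-assoc       = λ x y z → ∨-congʳ (∨-assoc x y z)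
    ; ∨-cong        = λ p q → trans ∨k-∨ (trans (∨-cong p q) (sym ∨k-∨))
    ; ∧-comm        = λ x y → ∨-congʳ (∧-comm x y)
    ; ∧-assoc       = λ x y z → ∨-congʳ (∧-assoc x y z)
    ; ∧-cong        = λ p q → trans ∨k-∧ (trans (∧-cong p q) (sym ∨k-∧))
    ; absorptive    = (λ x y → ∨-congʳ (∨-absorbs-∧ x y)) , (λ x y → ∨-congʳ (∧-absorbs-∨ x y))
    }

  quotient : BrouwerianAlgebra c ℓ
  quotient = record
    { Carrier  = Carrier
    ; _≈_      = _≈ₖ_
    ; _∧_      = _∧_
    ; _∨_      = _∨_
    ; _⇨_      = λ x y → x ⇨ (y ∨ k)
    ; ⊤        = ⊤
    ; isDistributiveLattice = record
      { isLattice   = ≈ₖ-isLattice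
      ; ∨-distrib-∧ = (λ x y z → ∨-congʳ (∨-distribˡ-∧ x y z)) , (λ x y z → ∨-congʳ (∨-distribʳ-∧ x y z))
      ; ∧-distrib-∨ = (λ x y z → ∨-congʳ (∧-distribˡ-∨ x y z)) , (λ x y z → ∨-congʳ (∧-distribʳ-∨ x y z))
      }
    ; ⊤-max    = λ x → ∨-congʳ (⊤-max x)
    ; ⇨-intro  = λ x y z p →
        from quotient-order (⊑-trans (curry (to quotient-order p)) ⊑∨ˡ)
    ; ⇨-elim   = λ x y z p →
        from quotient-order (uncurry (⊑-trans (to quotient-order p) (≈⇒⊑ (⊑⇒∨≈ k⊑⇨ₖ))))
    }

  quotientHeyting : HeytingAlgebra c ℓ
  quotientHeyting = record
    { brouwerian = quotient
    ; ⊥          = k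
    ; ⊥-min      = λ x → from quotient-order ⊑∨ʳ
    }

  eval-quotient : ∀ a u → ⟦_⟧ᴮ quotient a u ∨ k ≈ ⟦_⟧ᴮ B a (shift u k)
  eval-quotient (pvar n) u = refl
  eval-quotient (a ∧⁺ b) u = trans ∨k-∧ (∧-cong (eval-quotient a u) (eval-quotient b u))
  eval-quotient (a ∨⁺ b) u = trans ∨k-∨ (∨-cong (eval-quotient a u) (eval-quotient b u))
  eval-quotient (a ⇒⁺ b) u = trans ∨k-⇨ (⇨-cong (eval-quotient a u) (eval-quotient b u))

  quotient-truth : ∀ u a → TrueAt quotient u a ⇔ TrueAt B (shift u k) a
  quotient-truth u a = mk⇔
    (λ t → trans (sym (eval-quotient a u)) (trans t ⊤∨k≈⊤))
    (λ t → trans (eval-quotient a u) (trans t (sym ⊤∨k≈⊤)))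
    where
    ⊤∨k≈⊤ : ⊤ ∨ k ≈ ⊤
    ⊤∨k≈⊤ = ⊑⇒∨≈ ⊑⊤

  quotient-valid : ∀ a → BValid B a → BValid quotient a
  quotient-valid a valid u = from (quotient-truth u a) (valid (shift u k))

  quotient-rule : ∀ s → BRuleValid B s → BRuleValid quotient s
  quotient-rule (Γ / Δ) valid u =
    ruleHolds-cong (λ a → ⇔.sym (quotient-truth u a)) (Γ / Δ) (valid (shift u k))

  quotient-truth-above : ∀ u a → k ⊑ varMeet u a → TrueAt quotient u a ⇔ TrueAt B u a
  quotient-truth-above u a k⊑ = mk⇔
    (λ t → trans (sym (shift-invisible u k a k⊑)) (to (quotient-truth u a) t))
    (λ t → from (quotient-truth u a) (trans (shift-invisible u k a k⊑) t))

L-follows-of-P-follows : ∀ {c ℓ : Level} (P : PFormula → Set) (ℛ : PRule → Set) (r : PRule) →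
  PFollows c ℓ P ℛ r → LFollows c ℓ (IntPlusP P) ℛ r
L-follows-of-P-follows P ℛ r P-follows H H∈V_L H⊨ℛ =
  from (rule-embed r) (P-follows brouwerian reduct∈V_P reduct⊨ℛ)
  where
  open HeytingAlgebra H using (brouwerian)
  open Reduct H
  reduct∈V_P : InVP P brouwerian
  reduct∈V_P a a∈P = to (valid-embed a) (H∈V_L (embed a) (hyp (inj a a∈P)))
  reduct⊨ℛ : ∀ s → ℛ s → BRuleValid brouwerian s
  reduct⊨ℛ s s∈ℛ = to (rule-embed s) (H⊨ℛ s s∈ℛ)

P-follows-of-L-follows : ∀ {c ℓ : Level} (P : PFormula → Set) (ℛ : PRule → Set) (r : PRule) →
  LFollows c ℓ (IntPlusP P) ℛ r → PFollows c ℓ P ℛ r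
P-follows-of-L-follows P ℛ (Γ / Δ) L-follows B B∈V_P B⊨ℛ v =
  ruleHolds-transfer Γ Δ (All.map (λ {a} k⊑ → from (quotient-truth-above v a k⊑)) (proj₁ k-below))
                         (All.map (λ {a} k⊑ → to (quotient-truth-above v a k⊑)) (proj₂ k-below))
                         r-holds-in-quotient
  where
  open BrouwerianOrder B using (_⊑_; ⋀; ⋀-lower)
  open Shift B using (varMeet)
  k : BrouwerianAlgebra.Carrier B
  k = ⋀ (map (varMeet v) (Γ ++ Δ))
  open Quotient B k
  open Reduct quotientHeyting using (valid-embed; rule-embed)

  k-below : All (λ a → k ⊑ varMeet v a) Γ × All (λ a → k ⊑ varMeet v a) Δ
  k-below = Allₚ.++⁻ Γ (Allₚ.map⁻ (⋀-lower (map (varMeet v) (Γ ++ Δ))))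

  quotient∈V_L : InVL (IntPlusP P) quotientHeyting
  quotient∈V_L _ = Soundness.soundness quotientHeyting λ where
    _ (inj b b∈P) → from (valid-embed b) (quotient-valid b (B∈V_P b b∈P))

  quotient⊨ℛ : ∀ s → ℛ s → HRuleValid quotientHeyting (embedRule s)
  quotient⊨ℛ s s∈ℛ = from (rule-embed s) (quotient-rule s (B⊨ℛ s s∈ℛ))

  r-holds-in-quotient : RuleHolds (TrueAt quotient v) (Γ / Δ)
  r-holds-in-quotient = to (rule-embed (Γ / Δ)) (L-follows quotientHeyting quotient∈V_L quotient⊨ℛ) v

mainTheorem2 : ∀ {c ℓ : Level} (P : PFormula → Set) → PositiveLogic P →
    (ℛ : PRule → Set) (r : PRule) →
    PFollows c ℓ P ℛ r ⇔ LFollows c ℓ (IntPlusP P) ℛ r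
mainTheorem2 P _ ℛ r = mk⇔ (L-follows-of-P-follows P ℛ r) (P-follows-of-L-follows P ℛ r)
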